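{- Let $k\ge2$ be an integer and let $\Gamma$ and $\Gamma'$ be vertex-disjoint finite simple $(2k)$-regular graphs with distance magic labelings $\ell$ and $\ell'$, respectively. Let $d\ge 4$ be even and let $C=(u_0,\ldots,u_{d-1})$ and $C'=(v_0,\ldots,v_{d-1})$ be cyclets of length $d$ in $\Gamma$ and $\Gamma'$, respectively. Suppose that: (i) the bipartition $\{A',B'\}$ of $V(\Gamma')$ with $A'=\{v\colon \ell'(v)\ge0\}$, $B'=\{v\colon\ell'(v)<0\}$ is balanced; (ii) the cyclet $C'$ is alternating with respect to $\ell'$; (iii) $\ell(u_{i-1})+\ell(u_{i+1})=\ell'(v_{i-1})+\ell'(v_{i+1})$ for each $i\in\mathbb{Z}_d$ (indices mod $d$). Then the merged graph $\Gamma\oplus^{C}_{C'}\Gamma'$ is a $(2k)$-regular distance magic graph.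
   Context: For a positive integer $n$, $\mathcal{I}_n=\{1-n,3-n,\ldots,n-1\}$. For a regular graph $\Gamma$ of order $n$, a distance magic labeling is a bijection $\ell\colon V(\Gamma)\to\mathcal{I}_n$ such that for every vertex the sum of the labels of its neighbors equals $0$; a regular graph is distance magic if it admits one. A cyclet of length $d$ in a graph is a sequence $(w_0,\ldots,w_{d-1})$ of pairwise distinct vertices such that $w_iw_{i+1}$ is an edge for each $i\in\mathbb{Z}_d$; these $d$ edges are the edges of the cyclet (chords are not edges of the cyclet). The merge $\Gamma\oplus^C_{C'}\Gamma'$ of $\Gamma,\Gamma'$ with respect to cyclets $C=(u_0,\ldots,u_{d-1})$, $C'=(v_0,\ldots,v_{d-1})$ of equal length $d\ge3$ is obtained from the disjoint union of $\Gamma$ and $\Gamma'$ by deleting the $d$ edges of $C$ and the $d$ edges of $C'$ (keeping all vertices and all other edges) and adding the edges $u_iv_{i+1}$ and $v_iu_{i+1}$ for each $i\in\mathbb{Z}_d$. Given a bipartition $\{A,B\}$ of the vertex set of a graph, an edge is a link if it has one endvertex in $A$ and the other in $B$, and a non-link otherwise; the bipartition is balanced if every vertex has equally many neighbors in $A$ and in $B$; an even-length cyclet is alternating if its edges alternate between links and non-links. For a distance magic labeling $\ell$, links, non-links and alternating cyclets "with respect to $\ell$" refer to the bipartition $\{\{v\colon\ell(v)\ge0\},\{v\colon\ell(v)<0\}\}$. -}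

module Defs where

open import Data.Bool using (Bool; true; false; _∧_; _∨_; not; if_then_else_; _xor_)
open import Data.Nat as ℕ using (ℕ; zero; suc)
open import Data.Nat.DivMod using (_mod_)
open import Data.Fin using (Fin; zero; suc; toℕ; splitAt)
open import Data.Fin.Properties using (_≟_)
open import Data.Integer as ℤ using (ℤ; +_; _≤ᵇ_)
open import Data.Sum using (_⊎_; inj₁; inj₂)
open import Data.Product using (Σ; _×_; ∃)
open import Relation.Nullary.Decidable using (⌊_⌋)
open import Relation.Binary.PropositionalEquality using (_≡_; _≢_)
open import Function.Definitions using (Injective)

Graph : ℕ → Set
Graph n = Fin n → Fin n → Bool

IsSimple : ∀ {n} → Graph n → Set
IsSimple {n} G = (∀ x y → G x y ≡ G y x) × (∀ x → G x x ≡ false)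

sumℤ : ∀ {n} → (Fin n → ℤ) → ℤ
sumℤ {zero}  f = + 0
sumℤ {suc n} f = f zero ℤ.+ sumℤ (λ i → f (suc i))

count : ∀ {n} → (Fin n → Bool) → ℕ
count {zero}  p = 0
count {suc n} p = (if p zero then 1 else 0) ℕ.+ count (λ i → p (suc i))

anyFin : ∀ {n} → (Fin n → Bool) → Bool
anyFin {zero}  p = false
anyFin {suc n} p = p zero ∨ anyFin (λ i → p (suc i))

degree : ∀ {n} → Graph n → Fin n → ℕ
degree G v = count (G v)

Regular : ∀ {n} → Graph n → ℕ → Set
Regular G r = ∀ v → degree G v ≡ r

-- the label set I_n = {1-n, 3-n, ..., n-1}; its j-th element is 1-n+2j
labelI : (n : ℕ) → Fin n → ℤ
labelI n j = + (2 ℕ.* toℕ j ℕ.+ 1) ℤ.- + n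

IsDistanceMagicLabeling : ∀ {n} → Graph n → (Fin n → ℤ) → Set
IsDistanceMagicLabeling {n} G ℓ =
  (∀ v → ∃ λ j → ℓ v ≡ labelI n j) ×
  Injective _≡_ _≡_ ℓ ×
  (∀ j → ∃ λ v → ℓ v ≡ labelI n j) ×
  (∀ v → sumℤ (λ w → if G v w then ℓ w else + 0) ≡ + 0)

IsDistanceMagic : ∀ {n} → Graph n → Set
IsDistanceMagic {n} G = (∃ λ r → Regular G r) × ∃ λ ℓ → IsDistanceMagicLabeling G ℓ

next : ∀ {d} → Fin d → Fin d
next {suc m} i = suc (toℕ i) mod suc m

prev : ∀ {d} → Fin d → Fin d
prev {suc m} i = (toℕ i ℕ.+ m) mod suc m

IsCyclet : ∀ {n d} → Graph n → (Fin d → Fin n) → Set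
IsCyclet G c = Injective _≡_ _≡_ c × (∀ i → G (c i) (c (next i)) ≡ true)

_==_ : ∀ {n} → Fin n → Fin n → Bool
x == y = ⌊ x ≟ y ⌋

cycletEdge : ∀ {n d} → (Fin d → Fin n) → Fin n → Fin n → Bool
cycletEdge c x y = anyFin λ i →
  ((x == c i) ∧ (y == c (next i))) ∨ ((y == c i) ∧ (x == c (next i)))

merge : ∀ {n n' d} → Graph n → Graph n' → (Fin d → Fin n) → (Fin d → Fin n') →
        Graph (n ℕ.+ n')
merge {n} G G' u v x y with splitAt n x | splitAt n y
... | inj₁ a | inj₁ b = G a b ∧ not (cycletEdge u a b)
... | inj₂ a | inj₂ b = G' a b ∧ not (cycletEdge v a b)
... | inj₁ a | inj₂ b = anyFin λ i → ((a == u i) ∧ (b == v (next i))) ∨ ((b == v i) ∧ (a == u (next i)))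
... | inj₂ a | inj₁ b = anyFin λ i → ((b == u i) ∧ (a == v (next i))) ∨ ((a == v i) ∧ (b == u (next i)))

inA : ∀ {n} → (Fin n → ℤ) → Fin n → Bool
inA ℓ x = + 0 ≤ᵇ ℓ x

IsBalanced : ∀ {n} → Graph n → (Fin n → ℤ) → Set
IsBalanced G ℓ = ∀ v → count (λ w → G v w ∧ inA ℓ w) ≡ count (λ w → G v w ∧ not (inA ℓ w))

isLink : ∀ {n} → (Fin n → ℤ) → Fin n → Fin n → Bool
isLink ℓ x y = inA ℓ x xor inA ℓ y

IsAlternating : ∀ {n d} → (Fin n → ℤ) → (Fin d → Fin n) → Set
IsAlternating ℓ c = ∀ i → isLink ℓ (c i) (c (next i)) ≢ isLink ℓ (c (next i)) (c (next (next i)))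

module Submission where

-- Keep ℓ on Γ and push every label of Γ′ away from 0 by n: ℓ′ v ↦ ℓ′ v + n if ℓ′ v ≥ 0, and ℓ′ v − n
-- otherwise. Double counting the links of the balanced (2k)-regular Γ′ gives |A′| = |B′| = n′/2, so the new
-- labels are exactly I_{n+n′}: the negative half of I_{n′} shifted down, then I_n, then the nonnegative half
-- shifted up. Balance also keeps the neighbourhood sums in Γ′ at 0, as each vertex gains +n and −n equally
-- often. At a cyclet vertex the merge trades the neighbours u_{i±1} for v_{i±1} (or back); by (iii) the old
-- labels of these pairs have equal sums, and by alternation v_{i−1}, v_{i+1} lie on opposite sides, so their
-- shifts cancel. Regularity is the same computation with every label equal to 1.

open import Defs

open import Algebra.Bundles using (CommutativeMonoid)
import Algebra.Properties.CommutativeSemigroup as CommutativeSemigroupProperties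
open import Data.Bool using (Bool; true; false; _∧_; _∨_; not; if_then_else_; _xor_)
open import Data.Bool.Properties
  using (∧-comm; ∧-identityʳ; ∧-zeroʳ; ∨-comm; ∨-identityʳ; xor-comm; ∧-commutativeMonoid; ∨-commutativeMonoid)
open import Data.Fin using (Fin; zero; suc; toℕ; _↑ˡ_; _↑ʳ_; splitAt; join; cast)
open import Data.Fin.Properties
  using (_≟_; suc-injective; toℕ-injective; toℕ<n; toℕ-fromℕ<; toℕ-cast; cast-involutive; toℕ-↑ˡ; toℕ-↑ʳ;
         splitAt-↑ˡ; splitAt-↑ʳ; join-splitAt; +↔⊎; any?)
open import Data.Integer as ℤ using (ℤ; +_; _+_; _-_; -_; _⊖_)
import Data.Integer.Properties as ℤP
open import Data.Integer.Tactic.RingSolver using () renaming (solve-∀ to ℤ-solve-∀)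
open import Algebra.Properties.AbelianGroup ℤP.+-0-abelianGroup using () renaming (∙-cancelʳ to +-cancelʳ)
open import Algebra.Properties.CommutativeMonoid.Sum ℤP.+-0-commutativeMonoid
  using (sum; sum-cong-≗; ∑-distrib-+; ∑-comm)
open import Data.Nat as ℕ using (ℕ; zero; suc; _≤_; _<_; _*_; _%_; NonZero; s≤s)
import Data.Nat.Properties as ℕP
open import Data.Nat.DivMod using (%-distribˡ-+; m%n%n≡m%n; [m+n]%n≡m%n; m<n⇒m%n≡m; m≡m%n+[m/n]*n)
open import Data.Nat.Divisibility using (divides; ∣⇒≤)
open import Data.Nat.Tactic.RingSolver using () renaming (solve-∀ to ℕ-solve-∀)
open import Data.Product using (Σ; _×_; _,_; proj₁; proj₂)
open import Data.Sum using (_⊎_; inj₁; inj₂)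
open import Data.Sum.Algebra using (⊎-assoc; ⊎-comm; ⊎-cong)
open import Data.Vec.Functional using (_++_)
open import Data.Vec.Functional.Properties using (lookup-++ˡ; lookup-++ʳ)
open import Function.Base using (_∘_)
open import Function.Bundles using (_↔_; Inverse; Injection; mk⇔; mk↔ₛ′)
open import Function.Definitions using (Injective)
open import Function.Properties.Inverse using (↔⇒↣; ↔-refl; ↔-sym; ↔-trans)
import Function.Related.Propositional as Related
open import Level using (0ℓ)
open import Relation.Binary.PropositionalEquality
open import Relation.Nullary using (does; yes; no; contradiction)
open import Relation.Nullary.Decidable using (dec-false; does-⇔; isYes≗does)

module ∧ = CommutativeSemigroupProperties (CommutativeMonoid.commutativeSemigroup ∧-commutativeMonoid)
module ∨ = CommutativeSemigroupProperties (CommutativeMonoid.commutativeSemigroup ∨-commutativeMonoid)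
module ℤ+ = CommutativeSemigroupProperties ℤP.+-commutativeSemigroup

-- x == y is isYes (x ≟ y), which gets stuck on suc x == suc y, so the lemmas go through does.
==-does : ∀ {n} (x y : Fin n) → (x == y) ≡ does (x ≟ y)
==-does x y = isYes≗does (x ≟ y)

==-≢ : ∀ {n} {x y : Fin n} → x ≢ y → (x == y) ≡ false
==-≢ {x = x} {y} x≢y = trans (==-does x y) (dec-false (x ≟ y) x≢y)

==-⇔ : ∀ {m n} {x y : Fin m} {x′ y′ : Fin n} →
       (x ≡ y → x′ ≡ y′) → (x′ ≡ y′ → x ≡ y) → (x == y) ≡ (x′ == y′)
==-⇔ {x = x} {y} {x′} {y′} to from =
  trans (==-does x y) (trans (does-⇔ (mk⇔ to from) (x ≟ y) (x′ ≟ y′)) (sym (==-does x′ y′)))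

==-sym : ∀ {n} (x y : Fin n) → (x == y) ≡ (y == x)
==-sym x y = ==-⇔ sym sym

==-injective : ∀ {m n} {f : Fin m → Fin n} → Injective _≡_ _≡_ f → ∀ x y → (f x == f y) ≡ (x == y)
==-injective {f = f} f-inj x y = ==-⇔ f-inj (cong f)

anyFin-cong : ∀ {n} {P Q : Fin n → Bool} → (∀ i → P i ≡ Q i) → anyFin P ≡ anyFin Q
anyFin-cong {zero}  P≗Q = refl
anyFin-cong {suc n} P≗Q = cong₂ _∨_ (P≗Q zero) (anyFin-cong (λ i → P≗Q (suc i)))

anyFin-false : ∀ n → anyFin {n} (λ _ → false) ≡ false
anyFin-false zero    = refl
anyFin-false (suc n) = anyFin-false n

anyFin-∨ : ∀ {n} (P Q : Fin n → Bool) → anyFin (λ i → P i ∨ Q i) ≡ anyFin P ∨ anyFin Q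
anyFin-∨ {zero}  P Q = refl
anyFin-∨ {suc n} P Q =
  trans (cong ((P zero ∨ Q zero) ∨_) (anyFin-∨ (λ i → P (suc i)) (λ i → Q (suc i))))
        (∨.interchange (P zero) (Q zero) _ _)

anyFin-select : ∀ {n} (P : Fin n → Bool) j → anyFin (λ i → (i == j) ∧ P i) ≡ P j
anyFin-select {suc n} P zero    = trans (cong (P zero ∨_) (anyFin-false n)) (∨-identityʳ (P zero))
anyFin-select {suc n} P (suc j) = trans
  (anyFin-cong (λ i → cong (_∧ P (suc i)) (==-injective suc-injective i j)))
  (anyFin-select (λ i → P (suc i)) j)

[m%d+n]%d≡[m+n]%d : ∀ m n d .{{_ : NonZero d}} → (m % d ℕ.+ n) % d ≡ (m ℕ.+ n) % d
[m%d+n]%d≡[m+n]%d m n d = begin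
  (m % d ℕ.+ n) % d          ≡⟨ %-distribˡ-+ (m % d) n d ⟩
  (m % d % d ℕ.+ n % d) % d  ≡⟨ cong (λ x → (x ℕ.+ n % d) % d) (m%n%n≡m%n m d) ⟩
  (m % d ℕ.+ n % d) % d      ≡⟨ %-distribˡ-+ m n d ⟨
  (m ℕ.+ n) % d              ∎
  where open ≡-Reasoning

[m+n%d]%d≡[m+n]%d : ∀ m n d .{{_ : NonZero d}} → (m ℕ.+ n % d) % d ≡ (m ℕ.+ n) % d
[m+n%d]%d≡[m+n]%d m n d = begin
  (m ℕ.+ n % d) % d  ≡⟨ cong (_% d) (ℕP.+-comm m (n % d)) ⟩
  (n % d ℕ.+ m) % d  ≡⟨ [m%d+n]%d≡[m+n]%d n m d ⟩
  (n ℕ.+ m) % d      ≡⟨ cong (_% d) (ℕP.+-comm n m) ⟩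
  (m ℕ.+ n) % d      ∎
  where open ≡-Reasoning

toℕ-next : ∀ {m} (i : Fin (suc m)) → toℕ (next i) ≡ suc (toℕ i) % suc m
toℕ-next i = toℕ-fromℕ< _

toℕ-prev : ∀ {m} (i : Fin (suc m)) → toℕ (prev i) ≡ (toℕ i ℕ.+ m) % suc m
toℕ-prev i = toℕ-fromℕ< _

prev-next : ∀ {d} (i : Fin d) → prev (next i) ≡ i
prev-next {suc m} i = toℕ-injective (begin
  toℕ (prev (next i))              ≡⟨ toℕ-prev (next i) ⟩
  (toℕ (next i) ℕ.+ m) % suc m     ≡⟨ cong (λ x → (x ℕ.+ m) % suc m) (toℕ-next i) ⟩
  (suc t % suc m ℕ.+ m) % suc m    ≡⟨ [m%d+n]%d≡[m+n]%d (suc t) m (suc m) ⟩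
  (suc t ℕ.+ m) % suc m            ≡⟨ cong (_% suc m) (ℕP.+-suc t m) ⟨
  (t ℕ.+ suc m) % suc m            ≡⟨ [m+n]%n≡m%n t (suc m) ⟩
  t % suc m                        ≡⟨ m<n⇒m%n≡m (toℕ<n i) ⟩
  t                                ∎)
  where open ≡-Reasoning; t = toℕ i

next-prev : ∀ {d} (i : Fin d) → next (prev i) ≡ i
next-prev {suc m} i = toℕ-injective (begin
  toℕ (next (prev i))                  ≡⟨ toℕ-next (prev i) ⟩
  suc (toℕ (prev i)) % suc m           ≡⟨ cong (λ x → suc x % suc m) (toℕ-prev i) ⟩
  (1 ℕ.+ (t ℕ.+ m) % suc m) % suc m    ≡⟨ [m+n%d]%d≡[m+n]%d 1 (t ℕ.+ m) (suc m) ⟩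
  suc (t ℕ.+ m) % suc m                ≡⟨ cong (_% suc m) (ℕP.+-suc t m) ⟨
  (t ℕ.+ suc m) % suc m                ≡⟨ [m+n]%n≡m%n t (suc m) ⟩
  t % suc m                            ≡⟨ m<n⇒m%n≡m (toℕ<n i) ⟩
  t                                    ∎)
  where open ≡-Reasoning; t = toℕ i

toℕ-next² : ∀ {m} (i : Fin (suc m)) → toℕ (next (next i)) ≡ (2 ℕ.+ toℕ i) % suc m
toℕ-next² {m} i = begin
  toℕ (next (next i))                    ≡⟨ toℕ-next (next i) ⟩
  suc (toℕ (next i)) % suc m             ≡⟨ cong (λ x → suc x % suc m) (toℕ-next i) ⟩
  (1 ℕ.+ suc (toℕ i) % suc m) % suc m    ≡⟨ [m+n%d]%d≡[m+n]%d 1 (suc (toℕ i)) (suc m) ⟩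
  (2 ℕ.+ toℕ i) % suc m                  ∎
  where open ≡-Reasoning

-- Two steps around a cycle of length d return to the start only if d divides 2.
next²≢id : ∀ {d} → 3 ≤ d → (i : Fin d) → next (next i) ≢ i
next²≢id {suc m} 3≤d i next²i≡i = ℕP.<⇒≱ 3≤d (∣⇒≤ (divides q (ℕP.+-cancelˡ-≡ t 2 (q * suc m) (begin
  t ℕ.+ 2                            ≡⟨ ℕP.+-comm t 2 ⟩
  2 ℕ.+ t                            ≡⟨ m≡m%n+[m/n]*n (2 ℕ.+ t) (suc m) ⟩
  (2 ℕ.+ t) % suc m ℕ.+ q * suc m    ≡⟨ cong (ℕ._+ q * suc m) (trans (sym (toℕ-next² i)) (cong toℕ next²i≡i)) ⟩
  t ℕ.+ q * suc m                    ∎))))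
  where
  open ≡-Reasoning
  t = toℕ i
  q = (2 ℕ.+ t) ℕ./ suc m

next≢prev : ∀ {d} → 3 ≤ d → (i : Fin d) → next i ≢ prev i
next≢prev 3≤d i next≡prev = next²≢id 3≤d i (trans (cong next next≡prev) (next-prev i))

==-next-prev : ∀ {d} (i j : Fin d) → (j == next i) ≡ (i == prev j)
==-next-prev i j = ==-⇔ (λ j≡next → trans (sym (prev-next i)) (cong prev (sym j≡next)))
                        (λ i≡prev → trans (sym (next-prev j)) (cong next (sym i≡prev)))

sumℤ≡sum : ∀ {n} (f : Fin n → ℤ) → sumℤ f ≡ sum f
sumℤ≡sum {zero}  f = refl
sumℤ≡sum {suc n} f = cong (λ s → f zero + s) (sumℤ≡sum (λ i → f (suc i)))

sumℤ-cong : ∀ {n} {f g : Fin n → ℤ} → (∀ i → f i ≡ g i) → sumℤ f ≡ sumℤ g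
sumℤ-cong {zero}  f≗g = refl
sumℤ-cong {suc n} f≗g = cong₂ _+_ (f≗g zero) (sumℤ-cong (λ i → f≗g (suc i)))

sumℤ-zero : ∀ n → sumℤ {n} (λ _ → + 0) ≡ + 0
sumℤ-zero zero    = refl
sumℤ-zero (suc n) = trans (ℤP.+-identityˡ _) (sumℤ-zero n)

sumℤ-+ : ∀ {n} (f g : Fin n → ℤ) → sumℤ (λ i → f i + g i) ≡ sumℤ f + sumℤ g
sumℤ-+ f g = begin
  sumℤ (λ i → f i + g i)  ≡⟨ sumℤ≡sum (λ i → f i + g i) ⟩
  sum (λ i → f i + g i)   ≡⟨ ∑-distrib-+ f g ⟩
  sum f + sum g           ≡⟨ cong₂ _+_ (sumℤ≡sum f) (sumℤ≡sum g) ⟨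
  sumℤ f + sumℤ g         ∎
  where open ≡-Reasoning

sumℤ-comm : ∀ {m n} (f : Fin m → Fin n → ℤ) →
            sumℤ (λ i → sumℤ (λ j → f i j)) ≡ sumℤ (λ j → sumℤ (λ i → f i j))
sumℤ-comm f = begin
  sumℤ (λ i → sumℤ (λ j → f i j))  ≡⟨ sumℤ≡sum (λ i → sumℤ (λ j → f i j)) ⟩
  sum (λ i → sumℤ (λ j → f i j))   ≡⟨ sum-cong-≗ (λ i → sumℤ≡sum (f i)) ⟩
  sum (λ i → sum (λ j → f i j))    ≡⟨ ∑-comm f ⟩
  sum (λ j → sum (λ i → f i j))    ≡⟨ sum-cong-≗ (λ j → sumℤ≡sum (λ i → f i j)) ⟨
  sum (λ j → sumℤ (λ i → f i j))   ≡⟨ sumℤ≡sum (λ j → sumℤ (λ i → f i j)) ⟨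
  sumℤ (λ j → sumℤ (λ i → f i j))  ∎
  where open ≡-Reasoning

sumℤ-splitAt : ∀ m n (f : Fin (m ℕ.+ n) → ℤ) → sumℤ f ≡ sumℤ (λ i → f (i ↑ˡ n)) + sumℤ (λ j → f (m ↑ʳ j))
sumℤ-splitAt zero    n f = sym (ℤP.+-identityˡ (sumℤ f))
sumℤ-splitAt (suc m) n f = trans (cong (λ s → f zero + s) (sumℤ-splitAt m n (λ i → f (suc i)))) (sym (ℤP.+-assoc (f zero) _ _))

sumℤ-select : ∀ {n} (f : Fin n → ℤ) x → sumℤ (λ i → if i == x then f i else + 0) ≡ f x
sumℤ-select {suc n} f zero    = trans (cong (λ s → f zero + s) (sumℤ-zero n)) (ℤP.+-identityʳ (f zero))
sumℤ-select {suc n} f (suc x) = begin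
  + 0 + sumℤ (λ i → if suc i == suc x then f (suc i) else + 0)  ≡⟨ ℤP.+-identityˡ _ ⟩
  sumℤ (λ i → if suc i == suc x then f (suc i) else + 0)
    ≡⟨ sumℤ-cong (λ i → cong (λ b → if b then f (suc i) else + 0) (==-injective suc-injective i x)) ⟩
  sumℤ (λ i → if i == x then f (suc i) else + 0)                ≡⟨ sumℤ-select (λ i → f (suc i)) x ⟩
  f (suc x)                                                     ∎
  where open ≡-Reasoning

sumℤ-pair : ∀ {n} (f : Fin n → ℤ) {x y} → x ≢ y → sumℤ (λ i → if (i == x) ∨ (i == y) then f i else + 0) ≡ f x + f y
sumℤ-pair f {x} {y} x≢y = begin
  sumℤ (λ i → if (i == x) ∨ (i == y) then f i else + 0)
    ≡⟨ sumℤ-cong split ⟩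
  sumℤ (λ i → (if i == x then f i else + 0) + (if i == y then f i else + 0))
    ≡⟨ sumℤ-+ (λ i → if i == x then f i else + 0) (λ i → if i == y then f i else + 0) ⟩
  sumℤ (λ i → if i == x then f i else + 0) + sumℤ (λ i → if i == y then f i else + 0)
    ≡⟨ cong₂ _+_ (sumℤ-select f x) (sumℤ-select f y) ⟩
  f x + f y ∎
  where
  open ≡-Reasoning
  split : ∀ i → (if (i == x) ∨ (i == y) then f i else + 0) ≡ (if i == x then f i else + 0) + (if i == y then f i else + 0)
  split i with i ≟ x | i ≟ y
  ... | yes refl | yes refl = contradiction refl x≢y
  ... | yes _    | no _     = sym (ℤP.+-identityʳ (f i))
  ... | no _     | yes _    = sym (ℤP.+-identityˡ (f i))
  ... | no _     | no _     = refl

sumℤ-remove : ∀ {n} (g c : Fin n → Bool) (f : Fin n → ℤ) → (∀ i → c i ≡ true → g i ≡ true) →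
  sumℤ (λ i → if g i ∧ not (c i) then f i else + 0) + sumℤ (λ i → if c i then f i else + 0) ≡
  sumℤ (λ i → if g i then f i else + 0)
sumℤ-remove g c f c⊆g =
  trans (sym (sumℤ-+ (λ i → if g i ∧ not (c i) then f i else + 0) (λ i → if c i then f i else + 0)))
        (sumℤ-cong pointwise)
  where
  pointwise : ∀ i → (if g i ∧ not (c i) then f i else + 0) + (if c i then f i else + 0) ≡ (if g i then f i else + 0)
  pointwise i with c i in ci | g i in gi
  ... | false | true  = ℤP.+-identityʳ (f i)
  ... | false | false = refl
  ... | true  | true  = ℤP.+-identityˡ (f i)
  ... | true  | false = contradiction (trans (sym gi) (c⊆g i ci)) λ ()

sumℤ-indicator : ∀ {n} (p : Fin n → Bool) c → sumℤ (λ i → if p i then c else + 0) ≡ + count p ℤ.* c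
sumℤ-indicator {zero}  p c = refl
sumℤ-indicator {suc n} p c with p zero
... | true  = trans (cong (λ s → c + s) (sumℤ-indicator (λ i → p (suc i)) c)) (sym (ℤP.suc-* (+ count (λ i → p (suc i))) c))
... | false = trans (ℤP.+-identityˡ _) (sumℤ-indicator (λ i → p (suc i)) c)

count-true : ∀ n → count {n} (λ _ → true) ≡ n
count-true zero    = refl
count-true (suc n) = cong suc (count-true n)

count-∧-split : ∀ {n} (p q : Fin n → Bool) → count p ≡ count (λ i → p i ∧ q i) ℕ.+ count (λ i → p i ∧ not (q i))
count-∧-split {zero}  p q = refl
count-∧-split {suc n} p q with p zero | q zero
... | true  | true  = cong suc (count-∧-split (λ i → p (suc i)) (λ i → q (suc i)))
... | true  | false = trans (cong suc (count-∧-split (λ i → p (suc i)) (λ i → q (suc i)))) (sym (ℕP.+-suc _ _))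
... | false | _     = count-∧-split (λ i → p (suc i)) (λ i → q (suc i))

count-as-sum : ∀ {n} (p : Fin n → Bool) → + count p ≡ sumℤ (λ i → if p i then + 1 else + 0)
count-as-sum p = sym (trans (sumℤ-indicator p (+ 1)) (ℤP.*-identityʳ (+ count p)))

-- Neighbourhood sums and balanced bipartitions

nbrSum : ∀ {n} → Graph n → (Fin n → ℤ) → Fin n → ℤ
nbrSum G f x = sumℤ (λ w → if G x w then f w else + 0)

nbrSum-cong : ∀ {n} (G : Graph n) {f g : Fin n → ℤ} → (∀ w → f w ≡ g w) → ∀ x → nbrSum G f x ≡ nbrSum G g x
nbrSum-cong G f≗g x = sumℤ-cong (λ w → cong (if G x w then_else + 0) (f≗g w))

nbrSum-+ : ∀ {n} (G : Graph n) (f g : Fin n → ℤ) x → nbrSum G (λ w → f w + g w) x ≡ nbrSum G f x + nbrSum G g x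
nbrSum-+ G f g x = trans (sumℤ-cong if-+) (sumℤ-+ (λ w → if G x w then f w else + 0) (λ w → if G x w then g w else + 0))
  where
  if-+ : ∀ w → (if G x w then f w + g w else + 0) ≡ (if G x w then f w else + 0) + (if G x w then g w else + 0)
  if-+ w with G x w
  ... | true  = refl
  ... | false = refl

balanced⇒nbrSum-sign≡0 : ∀ {n} {G : Graph n} {ℓ : Fin n → ℤ} → IsBalanced G ℓ →
                          ∀ c x → nbrSum G (λ w → if inA ℓ w then c else - c) x ≡ + 0
balanced⇒nbrSum-sign≡0 {G = G} {ℓ} bal c x = begin
  nbrSum G (λ w → if inA ℓ w then c else - c) x
    ≡⟨ sumℤ-cong split ⟩
  sumℤ (λ w → (if G x w ∧ inA ℓ w then c else + 0) + (if G x w ∧ not (inA ℓ w) then - c else + 0))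
    ≡⟨ sumℤ-+ (λ w → if G x w ∧ inA ℓ w then c else + 0) (λ w → if G x w ∧ not (inA ℓ w) then - c else + 0) ⟩
  sumℤ (λ w → if G x w ∧ inA ℓ w then c else + 0) + sumℤ (λ w → if G x w ∧ not (inA ℓ w) then - c else + 0)
    ≡⟨ cong₂ _+_ (sumℤ-indicator (λ w → G x w ∧ inA ℓ w) c) (sumℤ-indicator (λ w → G x w ∧ not (inA ℓ w)) (- c)) ⟩
  + count (λ w → G x w ∧ inA ℓ w) ℤ.* c + + q ℤ.* - c
    ≡⟨ cong (λ p → + p ℤ.* c + + q ℤ.* - c) (bal x) ⟩
  + q ℤ.* c + + q ℤ.* - c
    ≡⟨ cancel (+ q) c ⟩
  + 0 ∎
  where
  open ≡-Reasoning
  q = count (λ w → G x w ∧ not (inA ℓ w))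
  cancel : ∀ a c → a ℤ.* c + a ℤ.* - c ≡ + 0
  cancel = ℤ-solve-∀
  split : ∀ w → (if G x w then (if inA ℓ w then c else - c) else + 0) ≡
                (if G x w ∧ inA ℓ w then c else + 0) + (if G x w ∧ not (inA ℓ w) then - c else + 0)
  split w with G x w | inA ℓ w
  ... | true  | true  = sym (ℤP.+-identityʳ c)
  ... | true  | false = sym (ℤP.+-identityˡ (- c))
  ... | false | _     = refl

arcs : ∀ {n} → Graph n → (Fin n → Bool) → (Fin n → Bool) → ℤ
arcs G p q = sumℤ (λ x → sumℤ (λ y → if p x ∧ (G x y ∧ q y) then + 1 else + 0))

arcs-regular : ∀ {n} (G : Graph n) (p q : Fin n → Bool) {k} → (∀ x → count (λ y → G x y ∧ q y) ≡ k) →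
               arcs G p q ≡ + count p ℤ.* + k
arcs-regular {n} G p q {k} deg = trans (sumℤ-cong out-degree) (sumℤ-indicator p (+ k))
  where
  out-degree : ∀ x → sumℤ (λ y → if p x ∧ (G x y ∧ q y) then + 1 else + 0) ≡ (if p x then + k else + 0)
  out-degree x with p x
  ... | true  = trans (sym (count-as-sum (λ y → G x y ∧ q y))) (cong +_ (deg x))
  ... | false = sumℤ-zero n

arcs-sym : ∀ {n} (G : Graph n) → (∀ x y → G x y ≡ G y x) → ∀ p q → arcs G p q ≡ arcs G q p
arcs-sym G G-sym p q =
  trans (sumℤ-comm (λ x y → if p x ∧ (G x y ∧ q y) then + 1 else + 0)) (sumℤ-cong λ y → sumℤ-cong λ x →
  cong (if_then + 1 else + 0) (trans (cong (λ e → p x ∧ (e ∧ q y)) (G-sym x y)) (∧.x∙yz≈z∙yx (p x) (G y x) (q y))))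

equal-side-degrees⇒equal-sides : ∀ {n} (G : Graph n) → (∀ x y → G x y ≡ G y x) → (P : Fin n → Bool) →
  ∀ k .{{_ : NonZero k}} →
  (∀ x → count (λ y → G x y ∧ P y) ≡ k) → (∀ x → count (λ y → G x y ∧ not (P y)) ≡ k) →
  count P ≡ count (λ y → not (P y))
equal-side-degrees⇒equal-sides G G-sym P k degA degB = ℕP.*-cancelʳ-≡ _ _ k (ℤP.+-injective (begin
  + (count P * k)                      ≡⟨ ℤP.pos-* (count P) k ⟩
  + count P ℤ.* + k                    ≡⟨ arcs-regular G P (λ y → not (P y)) degB ⟨
  arcs G P (λ y → not (P y))           ≡⟨ arcs-sym G G-sym P (λ y → not (P y)) ⟩
  arcs G (λ y → not (P y)) P           ≡⟨ arcs-regular G (λ y → not (P y)) P degA ⟩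
  + count (λ y → not (P y)) ℤ.* + k    ≡⟨ ℤP.pos-* (count (λ y → not (P y))) k ⟨
  + (count (λ y → not (P y)) * k)      ∎))
  where open ≡-Reasoning

balanced-regular⇒half-degree : ∀ {n} {G : Graph n} {ℓ : Fin n → ℤ} {k} → IsBalanced G ℓ → Regular G (2 * k) →
                               ∀ x → count (λ y → G x y ∧ inA ℓ y) ≡ k
balanced-regular⇒half-degree {G = G} {ℓ} {k} bal reg x = ℕP.*-cancelˡ-≡ _ k 2 (begin
  2 * cA             ≡⟨ cong (cA ℕ.+_) (ℕP.+-identityʳ cA) ⟩
  cA ℕ.+ cA            ≡⟨ cong (cA ℕ.+_) (bal x) ⟩
  cA ℕ.+ count (λ y → G x y ∧ not (inA ℓ y))  ≡⟨ count-∧-split (G x) (inA ℓ) ⟨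
  degree G x           ≡⟨ reg x ⟩
  2 * k              ∎)
  where
  open ≡-Reasoning
  cA = count (λ y → G x y ∧ inA ℓ y)

equal-sides⇒even : ∀ {n} (P : Fin n → Bool) → count P ≡ count (λ y → not (P y)) → n ≡ count P ℕ.+ count P
equal-sides⇒even {n} P eq = trans (sym (count-true n)) (trans (count-∧-split (λ _ → true) P) (cong (count P ℕ.+_) (sym eq)))

balanced-regular⇒even : ∀ {n} {G : Graph n} {ℓ : Fin n → ℤ} k .{{_ : NonZero k}} → (∀ x y → G x y ≡ G y x) →
                        IsBalanced G ℓ → Regular G (2 * k) → n ≡ count (inA ℓ) ℕ.+ count (inA ℓ)
balanced-regular⇒even {G = G} {ℓ} k G-sym bal reg =
  equal-sides⇒even (inA ℓ) (equal-side-degrees⇒equal-sides G G-sym (inA ℓ) k half (λ x → trans (sym (bal x)) (half x)))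
  where
  half : ∀ x → count (λ y → G x y ∧ inA ℓ y) ≡ k
  half = balanced-regular⇒half-degree {ℓ = ℓ} bal reg

-- Re-attaching a cyclet

crossEdge : ∀ {m n d} → (Fin d → Fin m) → (Fin d → Fin n) → Fin m → Fin n → Bool
crossEdge p q a b = anyFin λ i → ((a == p i) ∧ (b == q (next i))) ∨ ((b == q i) ∧ (a == p (next i)))

crossEdge-on : ∀ {m n d} (p : Fin d → Fin m) (q : Fin d → Fin n) → Injective _≡_ _≡_ p →
               ∀ j b → crossEdge p q (p j) b ≡ (b == q (next j)) ∨ (b == q (prev j))
crossEdge-on p q p-inj j b = begin
  crossEdge p q (p j) b
    ≡⟨ anyFin-cong reindex ⟩
  anyFin (λ i → ((i == j) ∧ (b == q (next i))) ∨ ((i == prev j) ∧ (b == q i)))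
    ≡⟨ anyFin-∨ (λ i → (i == j) ∧ (b == q (next i))) (λ i → (i == prev j) ∧ (b == q i)) ⟩
  anyFin (λ i → (i == j) ∧ (b == q (next i))) ∨ anyFin (λ i → (i == prev j) ∧ (b == q i))
    ≡⟨ cong₂ _∨_ (anyFin-select (λ i → b == q (next i)) j) (anyFin-select (λ i → b == q i) (prev j)) ⟩
  (b == q (next j)) ∨ (b == q (prev j)) ∎
  where
  open ≡-Reasoning
  reindex : ∀ i → ((p j == p i) ∧ (b == q (next i))) ∨ ((b == q i) ∧ (p j == p (next i))) ≡
                  ((i == j) ∧ (b == q (next i))) ∨ ((i == prev j) ∧ (b == q i))
  reindex i = cong₂ _∨_
    (cong (_∧ (b == q (next i))) (trans (==-injective p-inj j i) (==-sym j i)))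
    (trans (∧-comm (b == q i) _) (cong (_∧ (b == q i)) (trans (==-injective p-inj j (next i)) (==-next-prev i j))))

crossEdge-off : ∀ {m n d} (p : Fin d → Fin m) (q : Fin d → Fin n) {a} → (∀ j → p j ≢ a) →
                ∀ b → crossEdge p q a b ≡ false
crossEdge-off {d = d} p q {a} a∉p b = trans (anyFin-cong unmatched) (anyFin-false d)
  where
  unmatched : ∀ i → ((a == p i) ∧ (b == q (next i))) ∨ ((b == q i) ∧ (a == p (next i))) ≡ false
  unmatched i = trans (cong₂ (λ s t → (s ∧ (b == q (next i))) ∨ ((b == q i) ∧ t))
                             (==-≢ (a∉p i ∘ sym)) (==-≢ (a∉p (next i) ∘ sym)))
                      (∧-zeroʳ (b == q i))

sumℤ-crossEdge : ∀ {m n d} → 3 ≤ d → (p : Fin d → Fin m) (q : Fin d → Fin n) →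
                 Injective _≡_ _≡_ p → Injective _≡_ _≡_ q → ∀ (g : Fin n → ℤ) j →
                 sumℤ (λ b → if crossEdge p q (p j) b then g b else + 0) ≡ g (q (next j)) + g (q (prev j))
sumℤ-crossEdge 3≤d p q p-inj q-inj g j =
  trans (sumℤ-cong (λ b → cong (if_then g b else + 0) (crossEdge-on p q p-inj j b)))
        (sumℤ-pair g (next≢prev 3≤d j ∘ q-inj))

cyclet-prev-adjacent : ∀ {n d} {H : Graph n} {p : Fin d → Fin n} → (∀ x y → H x y ≡ H y x) → IsCyclet H p →
                       ∀ j → H (p j) (p (prev j)) ≡ true
cyclet-prev-adjacent {H = H} {p} H-sym (_ , adj) j =
  trans (H-sym (p j) (p (prev j))) (subst (λ i → H (p (prev j)) (p i) ≡ true) (next-prev j) (adj (prev j)))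

cycletEdge⇒adjacent : ∀ {n d} {H : Graph n} {p : Fin d → Fin n} → (∀ x y → H x y ≡ H y x) → IsCyclet H p →
                      ∀ j b → cycletEdge p (p j) b ≡ true → H (p j) b ≡ true
cycletEdge⇒adjacent {H = H} {p} H-sym p-cyc@(p-inj , adj) j b e = neighbour b (trans (sym (crossEdge-on p p p-inj j b)) e)
  where
  neighbour : ∀ b → ((b == p (next j)) ∨ (b == p (prev j))) ≡ true → H (p j) b ≡ true
  neighbour b e with b ≟ p (next j) | b ≟ p (prev j)
  ... | yes refl | _        = adj j
  ... | no _     | yes refl = cyclet-prev-adjacent H-sym p-cyc j
  ... | no _     | no _     = contradiction e λ ()

rewiredNbrSum : ∀ {m n d} → Graph m → (Fin d → Fin m) → (Fin d → Fin n) →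
                (Fin m → ℤ) → (Fin n → ℤ) → Fin m → ℤ
rewiredNbrSum H p q f g a =
  sumℤ (λ b → if H a b ∧ not (cycletEdge p a b) then f b else + 0) + sumℤ (λ b → if crossEdge p q a b then g b else + 0)

rewiredNbrSum-on-cyclet : ∀ {m n d} → 3 ≤ d → {H : Graph m} {p : Fin d → Fin m} {q : Fin d → Fin n} →
  (∀ x y → H x y ≡ H y x) → IsCyclet H p → Injective _≡_ _≡_ q → ∀ f g j →
  rewiredNbrSum H p q f g (p j) + (f (p (next j)) + f (p (prev j))) ≡ nbrSum H f (p j) + (g (q (next j)) + g (q (prev j)))
rewiredNbrSum-on-cyclet 3≤d {H} {p} {q} H-sym p-cyc@(p-inj , _) q-inj f g j = begin
  R + X + (f (p (next j)) + f (p (prev j)))  ≡⟨ ℤ+.xy∙z≈xz∙y R X _ ⟩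
  R + (f (p (next j)) + f (p (prev j))) + X  ≡⟨ cong (λ s → R + s + X) (sumℤ-crossEdge 3≤d p p p-inj p-inj f j) ⟨
  R + C + X                                  ≡⟨ cong (_+ X) (sumℤ-remove (H (p j)) (cycletEdge p (p j)) f
                                                                      (cycletEdge⇒adjacent H-sym p-cyc j)) ⟩
  nbrSum H f (p j) + X                       ≡⟨ cong (λ s → nbrSum H f (p j) + s) (sumℤ-crossEdge 3≤d p q p-inj q-inj g j) ⟩
  nbrSum H f (p j) + (g (q (next j)) + g (q (prev j))) ∎
  where
  open ≡-Reasoning
  R = sumℤ (λ b → if H (p j) b ∧ not (cycletEdge p (p j) b) then f b else + 0)
  C = sumℤ (λ b → if cycletEdge p (p j) b then f b else + 0)
  X = sumℤ (λ b → if crossEdge p q (p j) b then g b else + 0)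

rewiredNbrSum-off-cyclet : ∀ {m n d} (H : Graph m) (p : Fin d → Fin m) (q : Fin d → Fin n) f g {a} →
  (∀ j → p j ≢ a) → rewiredNbrSum H p q f g a ≡ nbrSum H f a
rewiredNbrSum-off-cyclet {n = n} H p q f g {a} a∉p = begin
  rewiredNbrSum H p q f g a
    ≡⟨ cong₂ _+_ (sumℤ-cong λ b → cong (λ e → if H a b ∧ not e then f b else + 0) (crossEdge-off p p a∉p b))
                 (sumℤ-cong λ b → cong (if_then g b else + 0) (crossEdge-off p q a∉p b)) ⟩
  sumℤ (λ b → if H a b ∧ true then f b else + 0) + sumℤ {n} (λ _ → + 0)
    ≡⟨ cong₂ _+_ (sumℤ-cong λ b → cong (if_then f b else + 0) (∧-identityʳ (H a b))) (sumℤ-zero n) ⟩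
  nbrSum H f a + + 0
    ≡⟨ ℤP.+-identityʳ (nbrSum H f a) ⟩
  nbrSum H f a ∎
  where open ≡-Reasoning

rewiredNbrSum-const : ∀ {m n d} → 3 ≤ d → {H : Graph m} {p : Fin d → Fin m} {q : Fin d → Fin n} →
  (∀ x y → H x y ≡ H y x) → IsCyclet H p → Injective _≡_ _≡_ q → ∀ {f g c} →
  (∀ a → nbrSum H f a ≡ c) → (∀ j → g (q (next j)) + g (q (prev j)) ≡ f (p (next j)) + f (p (prev j))) →
  ∀ a → rewiredNbrSum H p q f g a ≡ c
rewiredNbrSum-const 3≤d {H} {p} {q} H-sym p-cyc q-inj {f} {g} {c} nbrSum≡c exchange a with any? (λ j → p j ≟ a)
... | yes (j , refl) = +-cancelʳ (f (p (next j)) + f (p (prev j))) _ c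
  (trans (rewiredNbrSum-on-cyclet 3≤d H-sym p-cyc q-inj f g j) (cong₂ _+_ (nbrSum≡c (p j)) (exchange j)))
... | no a∉p = trans (rewiredNbrSum-off-cyclet H p q f g (λ j pj≡a → a∉p (j , pj≡a))) (nbrSum≡c a)

-- The merge

module _ {n n′ d} (G : Graph n) (G′ : Graph n′) (u : Fin d → Fin n) (v : Fin d → Fin n′) where

  private
    M : Graph (n ℕ.+ n′)
    M = merge G G′ u v

  merge-↑ˡ-↑ˡ : ∀ a b → M (a ↑ˡ n′) (b ↑ˡ n′) ≡ G a b ∧ not (cycletEdge u a b)
  merge-↑ˡ-↑ˡ a b rewrite splitAt-↑ˡ n a n′ | splitAt-↑ˡ n b n′ = refl

  merge-↑ˡ-↑ʳ : ∀ a b → M (a ↑ˡ n′) (n ↑ʳ b) ≡ crossEdge u v a b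
  merge-↑ˡ-↑ʳ a b rewrite splitAt-↑ˡ n a n′ | splitAt-↑ʳ n n′ b = refl

  merge-↑ʳ-↑ʳ : ∀ a b → M (n ↑ʳ a) (n ↑ʳ b) ≡ G′ a b ∧ not (cycletEdge v a b)
  merge-↑ʳ-↑ʳ a b rewrite splitAt-↑ʳ n n′ a | splitAt-↑ʳ n n′ b = refl

  merge-↑ʳ-↑ˡ : ∀ a b → M (n ↑ʳ a) (b ↑ˡ n′) ≡ crossEdge v u a b
  merge-↑ʳ-↑ˡ a b rewrite splitAt-↑ʳ n n′ a | splitAt-↑ˡ n b n′ =
    anyFin-cong (λ i → ∨-comm ((b == u i) ∧ (a == v (next i))) ((a == v i) ∧ (b == u (next i))))

  nbrSum-merge-↑ˡ : ∀ F a → nbrSum M F (a ↑ˡ n′) ≡ rewiredNbrSum G u v (λ b → F (b ↑ˡ n′)) (λ b → F (n ↑ʳ b)) a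
  nbrSum-merge-↑ˡ F a = trans (sumℤ-splitAt n n′ _) (cong₂ _+_
    (sumℤ-cong λ b → cong (if_then F (b ↑ˡ n′) else + 0) (merge-↑ˡ-↑ˡ a b))
    (sumℤ-cong λ b → cong (if_then F (n ↑ʳ b) else + 0) (merge-↑ˡ-↑ʳ a b)))

  nbrSum-merge-↑ʳ : ∀ F a → nbrSum M F (n ↑ʳ a) ≡ rewiredNbrSum G′ v u (λ b → F (n ↑ʳ b)) (λ b → F (b ↑ˡ n′)) a
  nbrSum-merge-↑ʳ F a = trans (sumℤ-splitAt n n′ _) (trans
    (ℤP.+-comm (sumℤ (λ b → if M (n ↑ʳ a) (b ↑ˡ n′) then F (b ↑ˡ n′) else + 0)) _) (cong₂ _+_
    (sumℤ-cong λ b → cong (if_then F (n ↑ʳ b) else + 0) (merge-↑ʳ-↑ʳ a b))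
    (sumℤ-cong λ b → cong (if_then F (b ↑ˡ n′) else + 0) (merge-↑ʳ-↑ˡ a b))))

  merge-nbrSum-const : 3 ≤ d → (∀ x y → G x y ≡ G y x) → (∀ x y → G′ x y ≡ G′ y x) →
    IsCyclet G u → IsCyclet G′ v →
    ∀ {F c} → (∀ a → nbrSum G (λ b → F (b ↑ˡ n′)) a ≡ c) → (∀ a → nbrSum G′ (λ b → F (n ↑ʳ b)) a ≡ c) →
    (∀ j → F (n ↑ʳ v (next j)) + F (n ↑ʳ v (prev j)) ≡ F (u (next j) ↑ˡ n′) + F (u (prev j) ↑ˡ n′)) →
    ∀ x → nbrSum M F x ≡ c
  merge-nbrSum-const 3≤d G-sym G′-sym u-cyc v-cyc {F} {c} G≡c G′≡c exchange x =
    subst (λ y → nbrSum M F y ≡ c) (join-splitAt n n′ x) (on-part (splitAt n x))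
    where
    on-part : ∀ s → nbrSum M F (join n n′ s) ≡ c
    on-part (inj₁ a) = trans (nbrSum-merge-↑ˡ F a)
                             (rewiredNbrSum-const 3≤d G-sym u-cyc (proj₁ v-cyc) G≡c exchange a)
    on-part (inj₂ b) = trans (nbrSum-merge-↑ʳ F b)
                             (rewiredNbrSum-const 3≤d G′-sym v-cyc (proj₁ u-cyc) G′≡c (sym ∘ exchange) b)

  merge-regular : ∀ {r} → 3 ≤ d → (∀ x y → G x y ≡ G y x) → (∀ x y → G′ x y ≡ G′ y x) →
                  IsCyclet G u → IsCyclet G′ v → Regular G r → Regular G′ r → Regular M r
  merge-regular 3≤d G-sym G′-sym u-cyc v-cyc G-reg G′-reg x = ℤP.+-injective (trans (count-as-sum (M x))
    (merge-nbrSum-const 3≤d G-sym G′-sym u-cyc v-cyc (degree≡ G-reg) (degree≡ G′-reg) (λ _ → refl) x))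
    where
    degree≡ : ∀ {m} {H : Graph m} {r} → Regular H r → ∀ a → nbrSum H (λ _ → + 1) a ≡ + r
    degree≡ {H = H} H-reg a = trans (sym (count-as-sum (H a))) (cong +_ (H-reg a))

-- Labels

[+a]-[+b]≡[+c]-[+d] : ∀ a b c d → a ℕ.+ d ≡ c ℕ.+ b → + a - + b ≡ + c - + d
[+a]-[+b]≡[+c]-[+d] a b c d a+d≡c+b = begin
  + a - + b              ≡⟨ ℤP.[+m]-[+n]≡m⊖n a b ⟩
  a ⊖ b                  ≡⟨ ℤP.+-cancelˡ-⊖ d a b ⟨
  (d ℕ.+ a) ⊖ (d ℕ.+ b)  ≡⟨ cong₂ _⊖_ (trans (ℕP.+-comm d a) a+d≡c+b) (ℕP.+-comm d b) ⟩
  (c ℕ.+ b) ⊖ (b ℕ.+ d)  ≡⟨ cong (_⊖ (b ℕ.+ d)) (ℕP.+-comm c b) ⟩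
  (b ℕ.+ c) ⊖ (b ℕ.+ d)  ≡⟨ ℤP.+-cancelˡ-⊖ b c d ⟩
  c ⊖ d                  ≡⟨ ℤP.[+m]-[+n]≡m⊖n c d ⟨
  + c - + d              ∎
  where open ≡-Reasoning

-- labelI n j reduces to label n (toℕ j).
label : ℕ → ℕ → ℤ
label N t = + (2 * t ℕ.+ 1) - + N

outward : ℕ → ℤ → ℤ
outward n z = if + 0 ℤ.≤ᵇ z then + n else - + n

shiftOut : ℕ → ℤ → ℤ
shiftOut n z = z + outward n z

label-nonneg : ∀ {N} t → N ≤ 2 * t ℕ.+ 1 → (+ 0 ℤ.≤ᵇ label N t) ≡ true
label-nonneg {N} t le = cong (+ 0 ℤ.≤ᵇ_) (trans (ℤP.[+m]-[+n]≡m⊖n (2 * t ℕ.+ 1) N) (ℤP.⊖-≥ le))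

label-neg : ∀ {N} t → 2 * t ℕ.+ 1 < N → (+ 0 ℤ.≤ᵇ label N t) ≡ false
label-neg {N} t lt = trans (cong (+ 0 ℤ.≤ᵇ_) (trans (ℤP.[+m]-[+n]≡m⊖n (2 * t ℕ.+ 1) N) (ℤP.⊖-< lt)))
                           (negative (ℕP.m<n⇒0<n∸m lt))
  where
  negative : ∀ {k} → 0 < k → (+ 0 ℤ.≤ᵇ - + k) ≡ false
  negative {suc k} _ = refl

shiftOut-nonneg : ∀ n {N} t → N ≤ 2 * t ℕ.+ 1 → shiftOut n (label N t) ≡ label (n ℕ.+ N) (n ℕ.+ t)
shiftOut-nonneg n {N} t le = begin
  label N t + outward n (label N t)  ≡⟨ cong (λ b → label N t + (if b then + n else - + n)) (label-nonneg t le) ⟩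
  label N t + + n                    ≡⟨ move (+ (2 * t ℕ.+ 1)) (+ N) (+ n) ⟩
  + (2 * t ℕ.+ 1 ℕ.+ n) - + N      ≡⟨ [+a]-[+b]≡[+c]-[+d] _ N _ (n ℕ.+ N) (arith n N t) ⟩
  label (n ℕ.+ N) (n ℕ.+ t)          ∎
  where
  open ≡-Reasoning
  move : ∀ x y z → x - y + z ≡ x + z - y
  move = ℤ-solve-∀
  arith : ∀ n N t → 2 * t ℕ.+ 1 ℕ.+ n ℕ.+ (n ℕ.+ N) ≡ 2 * (n ℕ.+ t) ℕ.+ 1 ℕ.+ N
  arith = ℕ-solve-∀

shiftOut-neg : ∀ n {N} t → 2 * t ℕ.+ 1 < N → shiftOut n (label N t) ≡ label (n ℕ.+ N) t
shiftOut-neg n {N} t lt = begin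
  label N t + outward n (label N t)  ≡⟨ cong (λ b → label N t + (if b then + n else - + n)) (label-neg t lt) ⟩
  label N t + - + n                  ≡⟨ move (+ (2 * t ℕ.+ 1)) (+ N) (+ n) ⟩
  + (2 * t ℕ.+ 1) - (+ n + + N)    ≡⟨ cong (λ z → + (2 * t ℕ.+ 1) - z) (ℤP.pos-+ n N) ⟨
  label (n ℕ.+ N) t                  ∎
  where
  open ≡-Reasoning
  move : ∀ x y z → x - y + - z ≡ x - (z + y)
  move = ℤ-solve-∀

labelI-injective : ∀ n → Injective _≡_ _≡_ (labelI n)
labelI-injective n {i} {j} eq = toℕ-injective (ℕP.*-cancelˡ-≡ (toℕ i) (toℕ j) 2
  (ℕP.+-cancelʳ-≡ 1 _ _ (ℤP.+-injective (+-cancelʳ (- + n) (+ (2 * toℕ i ℕ.+ 1)) (+ (2 * toℕ j ℕ.+ 1)) eq))))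

PermutesI : ∀ {n} → (Fin n → ℤ) → Set
PermutesI {n} ℓ = Σ (Fin n ↔ Fin n) λ σ → ∀ x → ℓ x ≡ labelI n (Inverse.to σ x)

magic⇒permutesI : ∀ {n} {G : Graph n} {ℓ} → IsDistanceMagicLabeling G ℓ → PermutesI ℓ
magic⇒permutesI {n} {ℓ = ℓ} (in-I , ℓ-inj , onto-I , _) =
  mk↔ₛ′ index unindex index∘unindex unindex∘index , proj₂ ∘ in-I
  where
  index : Fin n → Fin n
  index x = proj₁ (in-I x)
  unindex : Fin n → Fin n
  unindex j = proj₁ (onto-I j)
  index∘unindex : ∀ j → index (unindex j) ≡ j
  index∘unindex j = labelI-injective n (trans (sym (proj₂ (in-I (unindex j)))) (proj₂ (onto-I j)))
  unindex∘index : ∀ x → unindex (index x) ≡ x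
  unindex∘index x = ℓ-inj (trans (proj₂ (onto-I (index x))) (sym (proj₂ (in-I x))))

permutesI⇒magic : ∀ {n} {G : Graph n} {ℓ : Fin n → ℤ} → PermutesI ℓ → (∀ x → nbrSum G ℓ x ≡ + 0) →
                  IsDistanceMagicLabeling G ℓ
permutesI⇒magic {n} (σ , ℓ≡) nbrSum≡0 =
  (λ x → to x , ℓ≡ x) ,
  (λ {x} {y} eq → Injection.injective (↔⇒↣ σ) (labelI-injective n (trans (sym (ℓ≡ x)) (trans eq (ℓ≡ y))))) ,
  (λ j → from j , trans (ℓ≡ (from j)) (cong (labelI n) (strictlyInverseˡ j))) ,
  nbrSum≡0
  where open Inverse σ

cast↔ : ∀ {m n} → m ≡ n → Fin m ↔ Fin n
cast↔ e = mk↔ₛ′ (cast e) (cast (sym e)) (cast-involutive e (sym e)) (cast-involutive (sym e) e)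

-- Orders I_{n+2h} as: the negative half of I_{2h}, then I_n, then the nonnegative half of I_{2h}.
mergedIndex : ∀ n h → (Fin n ⊎ (Fin h ⊎ Fin h)) ↔ Fin (n ℕ.+ (h ℕ.+ h))
mergedIndex n h = begin
  (Fin n ⊎ (Fin h ⊎ Fin h))  ↔⟨ ⊎-assoc 0ℓ (Fin n) (Fin h) (Fin h) ⟨
  ((Fin n ⊎ Fin h) ⊎ Fin h)  ↔⟨ ⊎-cong (⊎-comm (Fin n) (Fin h)) ↔-refl ⟩
  ((Fin h ⊎ Fin n) ⊎ Fin h)  ↔⟨ ⊎-cong (↔-sym +↔⊎) ↔-refl ⟩
  (Fin (h ℕ.+ n) ⊎ Fin h)    ↔⟨ +↔⊎ ⟨
  Fin (h ℕ.+ n ℕ.+ h)        ↔⟨ cast↔ (arith h n) ⟩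
  Fin (n ℕ.+ (h ℕ.+ h))      ∎
  where
  open Related.EquationalReasoning
  arith : ∀ h n → h ℕ.+ n ℕ.+ h ≡ n ℕ.+ (h ℕ.+ h)
  arith = ℕ-solve-∀

mergedIndex-inj₁ : ∀ n h (t : Fin n) → labelI (n ℕ.+ (h ℕ.+ h)) (Inverse.to (mergedIndex n h) (inj₁ t)) ≡ labelI n t
mergedIndex-inj₁ n h t = begin
  label (n ℕ.+ (h ℕ.+ h)) (toℕ (cast _ ((h ↑ʳ t) ↑ˡ h)))
    ≡⟨ cong (label (n ℕ.+ (h ℕ.+ h)))
            (trans (toℕ-cast _ ((h ↑ʳ t) ↑ˡ h)) (trans (toℕ-↑ˡ (h ↑ʳ t) h) (toℕ-↑ʳ h t))) ⟩
  label (n ℕ.+ (h ℕ.+ h)) (h ℕ.+ toℕ t)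
    ≡⟨ [+a]-[+b]≡[+c]-[+d] _ (n ℕ.+ (h ℕ.+ h)) _ n (arith n h (toℕ t)) ⟩
  label n (toℕ t) ∎
  where
  open ≡-Reasoning
  arith : ∀ n h t → 2 * (h ℕ.+ t) ℕ.+ 1 ℕ.+ n ≡ 2 * t ℕ.+ 1 ℕ.+ (n ℕ.+ (h ℕ.+ h))
  arith = ℕ-solve-∀

mergedIndex-inj₂ : ∀ n h (s : Fin h ⊎ Fin h) →
  labelI (n ℕ.+ (h ℕ.+ h)) (Inverse.to (mergedIndex n h) (inj₂ s)) ≡ shiftOut n (labelI (h ℕ.+ h) (join h h s))
mergedIndex-inj₂ n h (inj₁ s) = begin
  label (n ℕ.+ (h ℕ.+ h)) (toℕ (cast _ ((s ↑ˡ n) ↑ˡ h)))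
    ≡⟨ cong (label (n ℕ.+ (h ℕ.+ h)))
            (trans (toℕ-cast _ ((s ↑ˡ n) ↑ˡ h)) (trans (toℕ-↑ˡ (s ↑ˡ n) h) (toℕ-↑ˡ s n))) ⟩
  label (n ℕ.+ (h ℕ.+ h)) (toℕ s)
    ≡⟨ shiftOut-neg n (toℕ s) (lower-half (toℕ<n s)) ⟨
  shiftOut n (label (h ℕ.+ h) (toℕ s))
    ≡⟨ cong (λ t → shiftOut n (label (h ℕ.+ h) t)) (toℕ-↑ˡ s h) ⟨
  shiftOut n (label (h ℕ.+ h) (toℕ (s ↑ˡ h))) ∎
  where
  open ≡-Reasoning
  lower-half : ∀ {t} → t < h → 2 * t ℕ.+ 1 < h ℕ.+ h
  lower-half {t} t<h = subst (_≤ h ℕ.+ h) (arith t) (ℕP.+-mono-≤ t<h t<h)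
    where
    arith : ∀ t → suc t ℕ.+ suc t ≡ suc (2 * t ℕ.+ 1)
    arith = ℕ-solve-∀
mergedIndex-inj₂ n h (inj₂ s) = begin
  label (n ℕ.+ (h ℕ.+ h)) (toℕ (cast _ ((h ℕ.+ n) ↑ʳ s)))
    ≡⟨ cong (label (n ℕ.+ (h ℕ.+ h)))
            (trans (toℕ-cast _ ((h ℕ.+ n) ↑ʳ s)) (trans (toℕ-↑ʳ (h ℕ.+ n) s) (arith h n (toℕ s)))) ⟩
  label (n ℕ.+ (h ℕ.+ h)) (n ℕ.+ (h ℕ.+ toℕ s))
    ≡⟨ shiftOut-nonneg n (h ℕ.+ toℕ s) (upper-half (toℕ s)) ⟨
  shiftOut n (label (h ℕ.+ h) (h ℕ.+ toℕ s))
    ≡⟨ cong (λ t → shiftOut n (label (h ℕ.+ h) t)) (toℕ-↑ʳ h s) ⟨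
  shiftOut n (label (h ℕ.+ h) (toℕ (h ↑ʳ s))) ∎
  where
  open ≡-Reasoning
  arith : ∀ h n t → h ℕ.+ n ℕ.+ t ≡ n ℕ.+ (h ℕ.+ t)
  arith = ℕ-solve-∀
  upper-half : ∀ t → h ℕ.+ h ≤ 2 * (h ℕ.+ t) ℕ.+ 1
  upper-half t = subst (h ℕ.+ h ≤_) (arith′ h t) (ℕP.m≤m+n (h ℕ.+ h) (2 * t ℕ.+ 1))
    where
    arith′ : ∀ h t → h ℕ.+ h ℕ.+ (2 * t ℕ.+ 1) ≡ 2 * (h ℕ.+ t) ℕ.+ 1
    arith′ = ℕ-solve-∀

merged-permutesI : ∀ {n n′} h {ℓ : Fin n → ℤ} {ℓ′ : Fin n′ → ℤ} → n′ ≡ h ℕ.+ h →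
                   PermutesI ℓ → PermutesI ℓ′ → PermutesI (ℓ ++ shiftOut n ∘ ℓ′)
merged-permutesI {n} h {ℓ} {ℓ′} refl (σ , ℓ≡) (σ′ , ℓ′≡) = τ , ℓ≡τ
  where
  τ : Fin (n ℕ.+ (h ℕ.+ h)) ↔ Fin (n ℕ.+ (h ℕ.+ h))
  τ = ↔-trans +↔⊎ (↔-trans (⊎-cong σ (↔-trans σ′ +↔⊎)) (mergedIndex n h))
  ℓ≡τ : ∀ x → (ℓ ++ shiftOut n ∘ ℓ′) x ≡ labelI (n ℕ.+ (h ℕ.+ h)) (Inverse.to τ x)
  ℓ≡τ x with splitAt n x
  ... | inj₁ a = trans (ℓ≡ a) (sym (mergedIndex-inj₁ n h (Inverse.to σ a)))
  ... | inj₂ b = trans (cong (shiftOut n) (trans (ℓ′≡ b) (cong (labelI (h ℕ.+ h)) (sym (join-splitAt h h (Inverse.to σ′ b))))))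
                       (sym (mergedIndex-inj₂ n h (splitAt h (Inverse.to σ′ b))))

alternating⇒opposite-sides : ∀ {n d} {ℓ : Fin n → ℤ} {c : Fin d → Fin n} → IsAlternating ℓ c →
                             ∀ j → inA ℓ (c (prev j)) ≢ inA ℓ (c (next j))
alternating⇒opposite-sides {ℓ = ℓ} {c} alt j same-side =
  alt′ (trans (cong (_xor A (c j)) same-side) (xor-comm (A (c (next j))) (A (c j))))
  where
  A = inA ℓ
  alt′ : (A (c (prev j)) xor A (c j)) ≢ (A (c j) xor A (c (next j)))
  alt′ = subst (λ i → (A (c (prev j)) xor A (c i)) ≢ (A (c i) xor A (c (next i)))) (next-prev j) (alt (prev j))

shiftOut-opposite : ∀ n x y → (+ 0 ℤ.≤ᵇ x) ≢ (+ 0 ℤ.≤ᵇ y) → shiftOut n x + shiftOut n y ≡ x + y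
shiftOut-opposite n x y opposite = begin
  x + outward n x + (y + outward n y)    ≡⟨ ℤ+.interchange x (outward n x) y (outward n y) ⟩
  x + y + (outward n x + outward n y)    ≡⟨ cong (λ s → x + y + s) (cancel (+ 0 ℤ.≤ᵇ x) (+ 0 ℤ.≤ᵇ y) opposite) ⟩
  x + y + + 0                            ≡⟨ ℤP.+-identityʳ (x + y) ⟩
  x + y                                  ∎
  where
  open ≡-Reasoning
  cancel : ∀ a b → a ≢ b → (if a then + n else - + n) + (if b then + n else - + n) ≡ + 0
  cancel true  true  a≢b = contradiction refl a≢b
  cancel true  false _   = ℤP.+-inverseʳ (+ n)
  cancel false true  _   = ℤP.+-inverseˡ (+ n)
  cancel false false a≢b = contradiction refl a≢b

shiftOut-exchange : ∀ {n n′ d} {ℓ : Fin n → ℤ} {ℓ′ : Fin n′ → ℤ} {u : Fin d → Fin n} {v : Fin d → Fin n′} m →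
  IsAlternating ℓ′ v → (∀ j → ℓ (u (prev j)) + ℓ (u (next j)) ≡ ℓ′ (v (prev j)) + ℓ′ (v (next j))) →
  ∀ j → shiftOut m (ℓ′ (v (next j))) + shiftOut m (ℓ′ (v (prev j))) ≡ ℓ (u (next j)) + ℓ (u (prev j))
shiftOut-exchange {ℓ = ℓ} {ℓ′} {u} {v} m alt same-sums j = begin
  shiftOut m (ℓ′ (v (next j))) + shiftOut m (ℓ′ (v (prev j)))
    ≡⟨ shiftOut-opposite m (ℓ′ (v (next j))) (ℓ′ (v (prev j))) (alternating⇒opposite-sides {ℓ = ℓ′} alt j ∘ sym) ⟩
  ℓ′ (v (next j)) + ℓ′ (v (prev j))  ≡⟨ ℤP.+-comm (ℓ′ (v (next j))) (ℓ′ (v (prev j))) ⟩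
  ℓ′ (v (prev j)) + ℓ′ (v (next j))  ≡⟨ same-sums j ⟨
  ℓ (u (prev j)) + ℓ (u (next j))    ≡⟨ ℤP.+-comm (ℓ (u (prev j))) (ℓ (u (next j))) ⟩
  ℓ (u (next j)) + ℓ (u (prev j))    ∎
  where open ≡-Reasoning

shiftOut-nbrSum≡0 : ∀ {n} {G : Graph n} {ℓ : Fin n → ℤ} m → IsBalanced G ℓ → (∀ x → nbrSum G ℓ x ≡ + 0) →
                    ∀ x → nbrSum G (shiftOut m ∘ ℓ) x ≡ + 0
shiftOut-nbrSum≡0 {G = G} {ℓ} m bal ℓ-magic x = begin
  nbrSum G (shiftOut m ∘ ℓ) x                   ≡⟨ nbrSum-+ G ℓ (outward m ∘ ℓ) x ⟩
  nbrSum G ℓ x + nbrSum G (outward m ∘ ℓ) x     ≡⟨ cong₂ _+_ (ℓ-magic x)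
                                                               (balanced⇒nbrSum-sign≡0 {ℓ = ℓ} bal (+ m) x) ⟩
  + 0                                           ∎
  where open ≡-Reasoning

merged-nbrSum≡0 : ∀ {n n′ d} → 3 ≤ d → {G : Graph n} {G′ : Graph n′} {u : Fin d → Fin n} {v : Fin d → Fin n′} →
  (∀ x y → G x y ≡ G y x) → (∀ x y → G′ x y ≡ G′ y x) → IsCyclet G u → IsCyclet G′ v →
  {ℓ : Fin n → ℤ} {ℓ′ : Fin n′ → ℤ} → (∀ x → nbrSum G ℓ x ≡ + 0) → (∀ x → nbrSum G′ ℓ′ x ≡ + 0) →
  IsBalanced G′ ℓ′ → IsAlternating ℓ′ v →
  (∀ j → ℓ (u (prev j)) + ℓ (u (next j)) ≡ ℓ′ (v (prev j)) + ℓ′ (v (next j))) →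
  ∀ x → nbrSum (merge G G′ u v) (ℓ ++ shiftOut n ∘ ℓ′) x ≡ + 0
merged-nbrSum≡0 {n} {n′} 3≤d {G} {G′} {u} {v} G-sym G′-sym u-cyc v-cyc {ℓ} {ℓ′} ℓ-magic ℓ′-magic bal alt same-sums =
  merge-nbrSum-const G G′ u v 3≤d G-sym G′-sym u-cyc v-cyc
    (λ a → trans (nbrSum-cong G (lookup-++ˡ ℓ ℓ″) a) (ℓ-magic a))
    (λ b → trans (nbrSum-cong G′ (lookup-++ʳ ℓ ℓ″) b) (shiftOut-nbrSum≡0 {G = G′} n bal ℓ′-magic b))
    (λ j → begin
      (ℓ ++ ℓ″) (n ↑ʳ v (next j)) + (ℓ ++ ℓ″) (n ↑ʳ v (prev j))
        ≡⟨ cong₂ _+_ (lookup-++ʳ ℓ ℓ″ _) (lookup-++ʳ ℓ ℓ″ _) ⟩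
      ℓ″ (v (next j)) + ℓ″ (v (prev j))
        ≡⟨ shiftOut-exchange {ℓ = ℓ} {ℓ′} {u} {v} n alt same-sums j ⟩
      ℓ (u (next j)) + ℓ (u (prev j))
        ≡⟨ cong₂ _+_ (lookup-++ˡ ℓ ℓ″ _) (lookup-++ˡ ℓ ℓ″ _) ⟨
      (ℓ ++ ℓ″) (u (next j) ↑ˡ n′) + (ℓ ++ ℓ″) (u (prev j) ↑ˡ n′) ∎)
  where
  open ≡-Reasoning
  ℓ″ = shiftOut n ∘ ℓ′

proposition5p2 : (k n n' d : ℕ) → 2 ≤ k →
    (G : Graph n) → (G' : Graph n') → IsSimple G → IsSimple G' →
    Regular G (2 * k) → Regular G' (2 * k) →
    (ℓ : Fin n → ℤ) → (ℓ' : Fin n' → ℤ) →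
    IsDistanceMagicLabeling G ℓ → IsDistanceMagicLabeling G' ℓ' →
    4 ≤ d → (h : ℕ) → d ≡ 2 * h →
    (u : Fin d → Fin n) → (v : Fin d → Fin n') →
    IsCyclet G u → IsCyclet G' v →
    IsBalanced G' ℓ' →
    IsAlternating ℓ' v →
    (∀ i → ℓ (u (prev i)) + ℓ (u (next i)) ≡ ℓ' (v (prev i)) + ℓ' (v (next i))) →
    Regular (merge G G' u v) (2 * k) × IsDistanceMagic (merge G G' u v)
proposition5p2 k n n′ d (s≤s _) G G′ (G-sym , _) (G′-sym , _) G-reg G′-reg ℓ ℓ′ ℓ-magic ℓ′-magic 4≤d _ _ u v
               u-cyc v-cyc bal alt same-sums = M-reg , (2 * k , M-reg) , ℓ ++ shiftOut n ∘ ℓ′ , labelling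
  where
  3≤d : 3 ≤ d
  3≤d = ℕP.≤-trans (ℕP.n≤1+n 3) 4≤d
  M-reg : Regular (merge G G′ u v) (2 * k)
  M-reg = merge-regular G G′ u v 3≤d G-sym G′-sym u-cyc v-cyc G-reg G′-reg
  labelling : IsDistanceMagicLabeling (merge G G′ u v) (ℓ ++ shiftOut n ∘ ℓ′)
  labelling = permutesI⇒magic
    (merged-permutesI (count (inA ℓ′)) (balanced-regular⇒even {ℓ = ℓ′} k G′-sym bal G′-reg)
                      (magic⇒permutesI ℓ-magic) (magic⇒permutesI ℓ′-magic))
    (merged-nbrSum≡0 3≤d G-sym G′-sym u-cyc v-cyc (proj₂ (proj₂ (proj₂ ℓ-magic))) (proj₂ (proj₂ (proj₂ ℓ′-magic)))
                     bal alt same-sums)
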